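{- Let $n\ge 0$ and $m>1$ be integers. Let $Y,Z\subseteq D_n$ satisfy $\pi(Y)=Y$ and $\pi(Z)=Z$ for every permutation $\pi\in S_n$, and let $x,y\in D_n$ with $x\sim y$. Then: (1) $H(\{x\}\times Y\times Z)=H(\{y\}\times Y\times Z)$; (2) $H([x]\times Y\times Z)=\gamma(x)\cdot H(\{x\}\times Y\times Z)$; (3) if $m$ divides $\gamma(x)$, then $m$ divides $H([x]\times Y\times Z)$; (4) $m$ divides $H(E_{n,m}\times Y\times Z)$.
   Context: $D_n$ is the set of monotone Boolean functions $\{0,1\}^n\to\{0,1\}$ ($\{0,1\}^n$ ordered componentwise), partially ordered pointwise. $\top,\bot$ are the constant functions $1,0$; $x|y$ and $x\&y$ are pointwise max and min; $\mathrm{re}(x,y)=|\{z\in D_n:x\le z\le y\}|$. For $x,y,z\in D_n$, $$H(x,y,z)=\mathrm{re}(\bot,x\&y\&z)\cdot\sum_{s\in D_n,\ s\ge x|y|z}\mathrm{re}(x|y,s)\cdot\mathrm{re}(x|z,s)\cdot\mathrm{re}(y|z,s),$$ and for $A\subseteq D_n^3$, $H(A)=\sum_{(x,y,z)\in A}H(x,y,z)$. A permutation $\pi\in S_n$ acts on $g\in D_n$ by $\pi(g)=g\circ\pi$ where $\pi(u)=u\circ\pi$ for $u\in\{0,1\}^n$, and on subsets elementwise. $f\sim g$ iff $f=\pi(g)$ for some $\pi\in S_n$; $[f]$ is the class of $f$, $\gamma(f)=|[f]|$. $E_{n,m}=\{f\in D_n:\gamma(f)\equiv0\pmod m\}$.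 -}

module Defs where

open import Data.Bool using (Bool; true; false; _∧_; _∨_; not; if_then_else_)
open import Data.Nat using (ℕ; zero; suc; _+_; _*_)
open import Data.Nat.Divisibility using (_∣?_)
open import Data.Fin using (Fin)
import Data.Fin.Properties as FinP
open import Data.Vec using (Vec; []; _∷_; lookup; tabulate)
open import Data.List using (List; []; _∷_; _++_; map; filter; length; concatMap; allFin)
open import Data.Bool.ListAction using (all; any)
open import Data.Nat.ListAction using (sum)
open import Data.Product using (_×_; _,_; Σ)
open import Relation.Nullary.Decidable using (⌊_⌋)
open import Relation.Binary.PropositionalEquality using (_≡_)
import Data.Bool.Properties as BoolP

Pt : ℕ → Set
Pt n = Vec Bool n

allPts : (n : ℕ) → List (Pt n)
allPts zero    = [] ∷ []
allPts (suc n) = map (false ∷_) (allPts n) ++ map (true ∷_) (allPts n)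

_≤ᵇ_ : Bool → Bool → Bool
a ≤ᵇ b = not a ∨ b

_==ᵇ_ : Bool → Bool → Bool
a ==ᵇ b = ⌊ a BoolP.≟ b ⌋

ptLe : ∀ {n} → Pt n → Pt n → Bool
ptLe []       []       = true
ptLe (a ∷ u) (b ∷ v) = (a ≤ᵇ b) ∧ ptLe u v

-- Boolean functions {0,1}^n → {0,1}, canonically represented by their
-- Shannon decomposition (truth tables): BF (suc n) = (f|x₀=0 , f|x₀=1).

BF : ℕ → Set
BF zero    = Bool
BF (suc n) = BF n × BF n

eval : ∀ {n} → BF n → Pt n → Bool
eval {zero}  b       []          = b
eval {suc n} (f , g) (false ∷ u) = eval f u
eval {suc n} (f , g) (true ∷ u)  = eval g u

fromFun : ∀ {n} → (Pt n → Bool) → BF n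
fromFun {zero}  h = h []
fromFun {suc n} h = fromFun (λ u → h (false ∷ u)) , fromFun (λ u → h (true ∷ u))

allBF : (n : ℕ) → List (BF n)
allBF zero    = false ∷ true ∷ []
allBF (suc n) = concatMap (λ f → map (f ,_) (allBF n)) (allBF n)

isMono : ∀ {n} → BF n → Bool
isMono {n} f = all (λ u → all (λ v → not (ptLe u v) ∨ (eval f u ≤ᵇ eval f v)) (allPts n)) (allPts n)

D : (n : ℕ) → List (BF n)
D n = filter (λ f → isMono f BoolP.≟ true) (allBF n)

leF : ∀ {n} → BF n → BF n → Bool
leF {n} f g = all (λ u → eval f u ≤ᵇ eval g u) (allPts n)

eqF : ∀ {n} → BF n → BF n → Bool
eqF {n} f g = all (λ u → eval f u ==ᵇ eval g u) (allPts n)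

top bot : ∀ {n} → BF n
top = fromFun (λ _ → true)
bot = fromFun (λ _ → false)

_∣∣_ _&&_ : ∀ {n} → BF n → BF n → BF n
f ∣∣ g = fromFun (λ u → eval f u ∨ eval g u)
f && g = fromFun (λ u → eval f u ∧ eval g u)

re : ∀ {n} → BF n → BF n → ℕ
re {n} x y = length (filter (λ z → (leF x z ∧ leF z y) BoolP.≟ true) (D n))

H : ∀ {n} → BF n → BF n → BF n → ℕ
H {n} x y z =
  re bot (x && (y && z)) *
  sum (map (λ s → re (x ∣∣ y) s * re (x ∣∣ z) s * re (y ∣∣ z) s)
           (filter (λ s → leF ((x ∣∣ y) ∣∣ z) s BoolP.≟ true) (D n)))

-- Subsets of D_n are given by Boolean predicates P : BF n → Bool;
-- the subset is { f ∈ D_n | P f ≡ true }.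

Sub : ℕ → Set
Sub n = BF n → Bool

elems : ∀ {n} → Sub n → List (BF n)
elems {n} P = filter (λ f → P f BoolP.≟ true) (D n)

Hprod : ∀ {n} → Sub n → Sub n → Sub n → ℕ
Hprod P Q R =
  sum (concatMap (λ x → concatMap (λ y → map (λ z → H x y z) (elems R)) (elems Q)) (elems P))

-- Permutations π ∈ S_n, represented by the vector (π 0, …, π (n-1)).

allVecs : (k n : ℕ) → List (Vec (Fin n) k)
allVecs zero    n = [] ∷ []
allVecs (suc k) n = concatMap (λ i → map (i ∷_) (allVecs k n)) (allFin n)

isInjective : ∀ {n} → Vec (Fin n) n → Bool
isInjective {n} p =
  all (λ i → all (λ j → not ⌊ lookup p i FinP.≟ lookup p j ⌋ ∨ ⌊ i FinP.≟ j ⌋) (allFin n)) (allFin n)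

Sym : (n : ℕ) → List (Vec (Fin n) n)
Sym n = filter (λ p → isInjective p BoolP.≟ true) (allVecs n n)

actPt : ∀ {n} → Vec (Fin n) n → Pt n → Pt n
actPt p u = tabulate (λ i → lookup u (lookup p i))

act : ∀ {n} → Vec (Fin n) n → BF n → BF n
act p g = fromFun (λ u → eval g (actPt p u))

simᵇ : ∀ {n} → BF n → BF n → Bool
simᵇ {n} f g = any (λ p → eqF f (act p g)) (Sym n)

cls : ∀ {n} → BF n → Sub n
cls f g = simᵇ g f

γ : ∀ {n} → BF n → ℕ
γ f = length (elems (cls f))

single : ∀ {n} → BF n → Sub n
single x g = eqF g x

E : ∀ {n} → ℕ → Sub n
E m f = ⌊ m ∣? γ f ⌋

_∈D : ∀ {n} → BF n → Set
f ∈D = isMono f ≡ true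

_∈S_ : ∀ {n} → BF n → Sub n → Set
f ∈S P = (isMono f ≡ true) × (P f ≡ true)

_∼_ : ∀ {n} → BF n → BF n → Set
_∼_ {n} x y = Σ (Vec (Fin n) n) λ p → (isInjective p ≡ true) × (x ≡ act p y)

Invariant : ∀ {n} → Sub n → Set
Invariant {n} Y = (p : Vec (Fin n) n) → isInjective p ≡ true → (g : BF n) →
  ((g ∈S Y) → Σ (BF n) λ f → (f ∈S Y) × (act p f ≡ g)) ×
  ((Σ (BF n) λ f → (f ∈S Y) × (act p f ≡ g)) → g ∈S Y)

{-# OPTIONS --safe #-}
module Submission where

-- A permutation π acts on D_n as an order automorphism commuting with | and & and fixing ⊥,
-- so re and hence H are invariant under simultaneous action on all arguments.  Reindexing
-- the sums over the invariant sets Y and Z by π then shows that the row sum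
-- x ↦ H({x} × Y × Z) is constant on each class, so a class [x] contributes γ(x) times it.
-- Finally E_{n,m} is a disjoint union of classes, each of size divisible by m.

open import Defs
open import Data.Nat using (ℕ; _<_; _*_)
open import Data.Nat.Divisibility using (_∣_)
open import Data.Product using (_×_)
open import Relation.Binary.PropositionalEquality using (_≡_)

open import Data.Bool using (Bool; true; false; _∧_; _∨_; not)
open import Data.Bool.ListAction using (all; any)
open import Data.Bool.Properties using (_≟_; T-≡; ⇔→≡; ∧-zeroʳ)
open import Data.Fin using (Fin; zero; suc; punchOut)
open import Data.Fin.Properties using (any?; injective⇒≤; punchOut-injective) renaming (_≟_ to _≟ᶠ_)
open import Data.List
  using (List; []; _∷_; _++_; map; filter; length; concatMap; allFin; cartesianProduct)
open import Data.List.Membership.Propositional using (_∈_; find; lose)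
open import Data.List.Membership.Propositional.Properties
  using (∈-map⁺; ∈-map⁻; ∈-++⁺ˡ; ∈-++⁺ʳ; ∈-concatMap⁺; ∈-allFin; ∈-cartesianProduct⁺;
         ∈-filter⁺; ∈-filter⁻)
open import Data.List.Membership.Propositional.Properties.WithK using (unique∧set⇒bag)
open import Data.List.Properties
  using (map-cong; map-cong-local; map-∘; length-map; length-filter)
open import Data.List.Relation.Binary.BagAndSetEquality using (∼bag⇒↭)
open import Data.List.Relation.Binary.Permutation.Propositional using (_↭_; ↭-sym)
open import Data.List.Relation.Binary.Permutation.Propositional.Properties
  using (↭-length)
import Data.List.Relation.Binary.Permutation.Propositional.Properties as ↭
open import Data.List.Relation.Unary.All as All using (All)
import Data.List.Relation.Unary.AllPairs as AllPairs
open import Data.List.Relation.Unary.All.Properties using (all⁺; all⁻)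
open import Data.List.Relation.Unary.Any as Any using (here; there)
open import Data.List.Relation.Unary.Any.Properties using (any⁺; any⁻)
open import Data.List.Relation.Unary.Unique.Propositional using (Unique)
import Data.List.Relation.Unary.Unique.Propositional.Properties as Unique
open import Data.Nat using (zero; suc; _+_; _≤_; s≤s)
open import Data.Nat.Divisibility using (_∣?_; _∣0; ∣m∣n⇒∣m+n; ∣m⇒∣m*n)
open import Data.Nat.ListAction using (sum)
open import Data.Nat.ListAction.Properties using (sum-++; sum-↭)
open import Data.Nat.Properties
  using (+-assoc; +-identityʳ; ≤-refl; ≤-trans; 1+n≰n; +-commutativeSemigroup)
open import Algebra.Properties.CommutativeSemigroup +-commutativeSemigroup using (x∙yz≈y∙xz)
open import Data.Product using (_,_; proj₁; proj₂; ∃-syntax)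
open import Data.Vec using (Vec; []; _∷_; lookup; tabulate)
open import Data.Vec.Properties using (lookup∘tabulate; tabulate∘lookup; tabulate-cong)
open import Function using (_∘_; id; mk⇔; Equivalence; Injective)
open import Relation.Binary.PropositionalEquality
  using (refl; sym; trans; cong; cong₂; subst; subst₂; module ≡-Reasoning)
open import Relation.Nullary using (Dec; yes; no; contradiction)
open import Relation.Nullary.Decidable using (⌊_⌋; toWitness; fromWitness)
open import Relation.Unary using (Decidable)

private
  variable
    A : Set
    n : ℕ

true? : (p : A → Bool) → Decidable (λ a → p a ≡ true)
true? p a = p a ≟ true

isYes⁻ : {P : Set} (P? : Dec P) → ⌊ P? ⌋ ≡ true → P
isYes⁻ P? h = toWitness {a? = P?} (Equivalence.from T-≡ h)

isYes⁺ : {P : Set} (P? : Dec P) → P → ⌊ P? ⌋ ≡ true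
isYes⁺ P? p = Equivalence.to T-≡ (fromWitness {a? = P?} p)

implies⁻ : ∀ {a b} → (not a ∨ b) ≡ true → a ≡ true → b ≡ true
implies⁻ h refl = h

implies⁺ : ∀ a {b} → (a ≡ true → b ≡ true) → (not a ∨ b) ≡ true
implies⁺ true  h = h refl
implies⁺ false h = refl

bool-ext : ∀ {a b} → (a ≡ true → b ≡ true) → (b ≡ true → a ≡ true) → a ≡ b
bool-ext a⇒b b⇒a = ⇔→≡ (mk⇔ a⇒b b⇒a)

module _ (p : A → Bool) where

  all-true⁻ : ∀ {xs} → all p xs ≡ true → ∀ {x} → x ∈ xs → p x ≡ true
  all-true⁻ {xs} h x∈ = Equivalence.to T-≡ (All.lookup (all⁺ p xs (Equivalence.from T-≡ h)) x∈)

  all-true⁺ : ∀ xs → (∀ {x} → x ∈ xs → p x ≡ true) → all p xs ≡ true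
  all-true⁺ xs h = Equivalence.to T-≡ (all⁻ p (All.tabulate (Equivalence.from T-≡ ∘ h)))

  any-true⁻ : ∀ xs → any p xs ≡ true → ∃[ x ] x ∈ xs × p x ≡ true
  any-true⁻ xs h with x , x∈ , px ← find (any⁻ p xs (Equivalence.from T-≡ h)) =
    x , x∈ , Equivalence.to T-≡ px

  any-true⁺ : ∀ {xs x} → x ∈ xs → p x ≡ true → any p xs ≡ true
  any-true⁺ x∈ px = Equivalence.to T-≡ (any⁺ p (lose x∈ (Equivalence.from T-≡ px)))

filter-cong : {p q : A → Bool} (xs : List A) → (∀ {x} → x ∈ xs → p x ≡ q x) →
              filter (true? p) xs ≡ filter (true? q) xs
filter-cong [] _ = refl
filter-cong {p = p} {q} (x ∷ xs) p≡q with p x | q x | p≡q (here refl)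
... | true  | .true  | refl = cong (x ∷_) (filter-cong xs (p≡q ∘ there))
... | false | .false | refl = filter-cong xs (p≡q ∘ there)

filter-filter : (p q : A → Bool) (xs : List A) →
                filter (true? p) (filter (true? q) xs) ≡ filter (true? (λ a → p a ∧ q a)) xs
filter-filter p q [] = refl
filter-filter p q (x ∷ xs) with q x
... | false rewrite ∧-zeroʳ (p x) = filter-filter p q xs
... | true  with p x
...   | true  = cong (x ∷_) (filter-filter p q xs)
...   | false = filter-filter p q xs

unique-⇔⇒↭ : {xs ys : List A} → Unique xs → Unique ys →
             (∀ {a} → a ∈ xs → a ∈ ys) → (∀ {a} → a ∈ ys → a ∈ xs) → xs ↭ ys
unique-⇔⇒↭ xs! ys! to from = ∼bag⇒↭ (unique∧set⇒bag xs! ys! (mk⇔ to from))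

sum-map-↭ : (f : A → ℕ) {xs ys : List A} → xs ↭ ys → sum (map f xs) ≡ sum (map f ys)
sum-map-↭ f xs↭ys = sum-↭ (↭.map⁺ f xs↭ys)

sum-concatMap : (f : A → List ℕ) (xs : List A) → sum (concatMap f xs) ≡ sum (map (sum ∘ f) xs)
sum-concatMap f []       = refl
sum-concatMap f (x ∷ xs) =
  trans (sum-++ (f x) (concatMap f xs)) (cong (sum (f x) +_) (sum-concatMap f xs))

sum-map-const : (c : ℕ) (xs : List A) → sum (map (λ _ → c) xs) ≡ length xs * c
sum-map-const c []       = refl
sum-map-const c (x ∷ xs) = cong (c +_) (sum-map-const c xs)

sum-filter-split : (f : A → ℕ) (p : A → Bool) (xs : List A) →
  sum (map f xs) ≡ sum (map f (filter (true? p) xs)) + sum (map f (filter (true? (not ∘ p)) xs))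
sum-filter-split f p [] = refl
sum-filter-split f p (x ∷ xs) with p x
... | true  = trans (cong (f x +_) (sum-filter-split f p xs)) (sym (+-assoc (f x) _ _))
... | false = trans (cong (f x +_) (sum-filter-split f p xs))
  (x∙yz≈y∙xz (f x) (sum (map f (filter (true? p) xs))) (sum (map f (filter (true? (not ∘ p)) xs))))

class : (A → A → Bool) → A → List A → List A
class _≈_ g = filter (true? (_≈ g))

module _ (_≈_ : A → A → Bool)
         (≈-refl : ∀ a → (a ≈ a) ≡ true)
         (≈-sym : ∀ a b → (a ≈ b) ≡ true → (b ≈ a) ≡ true)
         (≈-trans : ∀ a b c → (a ≈ b) ≡ true → (b ≈ c) ≡ true → (a ≈ c) ≡ true)
         (f : A → ℕ) (m : ℕ) where

  ∣-sum-by-classes : (xs : List A) → (∀ {g} → g ∈ xs → m ∣ sum (map f (class _≈_ g xs))) →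
                     m ∣ sum (map f xs)
  ∣-sum-by-classes xs = go (length xs) xs ≤-refl
    where
    go : ∀ k xs → length xs ≤ k → (∀ {g} → g ∈ xs → m ∣ sum (map f (class _≈_ g xs))) →
         m ∣ sum (map f xs)
    go _       []       _         _      = m ∣0
    go (suc k) (g ∷ xs) (s≤s |xs|≤k) class∣ =
      subst (m ∣_) (sym (sum-filter-split f (_≈ g) (g ∷ xs)))
        (∣m∣n⇒∣m+n (class∣ (here refl)) (go k rest |rest|≤k rest-class∣))
      where
      rest : List A
      rest = filter (true? (not ∘ (_≈ g))) (g ∷ xs)

      rest≡ : rest ≡ filter (true? (not ∘ (_≈ g))) xs
      rest≡ rewrite ≈-refl g = refl

      |rest|≤k : length rest ≤ k
      |rest|≤k rewrite rest≡ = ≤-trans (length-filter (true? (not ∘ (_≈ g))) xs) |xs|≤k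

      -- a class disjoint from that of g is unchanged by removing g's class
      rest-class∣ : ∀ {h} → h ∈ rest → m ∣ sum (map f (class _≈_ h rest))
      rest-class∣ {h} h∈ with h∈g∷xs , h≉g ← ∈-filter⁻ (true? (not ∘ (_≈ g))) h∈ =
        subst (λ ys → m ∣ sum (map f ys)) (sym class≡) (class∣ h∈g∷xs)
        where
        drop-≉g : ∀ {a} → a ∈ g ∷ xs → ((a ≈ h) ∧ not (a ≈ g)) ≡ (a ≈ h)
        drop-≉g {a} _ with a ≈ h in a≈h | a ≈ g in a≈g
        ... | true  | true
          with () ← subst (λ b → not b ≡ true) (≈-trans h a g (≈-sym a h a≈h) a≈g) h≉g
        ... | true  | false = refl
        ... | false | _     = refl

        class≡ : class _≈_ h rest ≡ class _≈_ h (g ∷ xs)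
        class≡ = trans (filter-filter (_≈ h) (not ∘ (_≈ g)) (g ∷ xs)) (filter-cong (g ∷ xs) drop-≉g)

eval-fromFun : (h : Pt n → Bool) (u : Pt n) → eval (fromFun h) u ≡ h u
eval-fromFun {zero}  h []          = refl
eval-fromFun {suc n} h (false ∷ u) = eval-fromFun (λ u → h (false ∷ u)) u
eval-fromFun {suc n} h (true ∷ u)  = eval-fromFun (λ u → h (true ∷ u)) u

fromFun-cong : {h k : Pt n → Bool} → (∀ u → h u ≡ k u) → fromFun h ≡ fromFun k
fromFun-cong {zero}  h≡k = h≡k []
fromFun-cong {suc n} h≡k =
  cong₂ _,_ (fromFun-cong (h≡k ∘ (false ∷_))) (fromFun-cong (h≡k ∘ (true ∷_)))

fromFun-eval : (f : BF n) → fromFun (eval f) ≡ f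
fromFun-eval {zero}  b       = refl
fromFun-eval {suc n} (f , g) = cong₂ _,_ (fromFun-eval f) (fromFun-eval g)

BF-ext : {f g : BF n} → (∀ u → eval f u ≡ eval g u) → f ≡ g
BF-ext {f = f} {g} f≡g = trans (sym (fromFun-eval f)) (trans (fromFun-cong f≡g) (fromFun-eval g))

∈-allPts : (u : Pt n) → u ∈ allPts n
∈-allPts []          = here refl
∈-allPts (false ∷ u) = ∈-++⁺ˡ (∈-map⁺ (false ∷_) (∈-allPts u))
∈-allPts {suc n} (true ∷ u) = ∈-++⁺ʳ (map (false ∷_) (allPts n)) (∈-map⁺ (true ∷_) (∈-allPts u))

concatMap-pairs : (xs ys : List (BF n)) →
                  concatMap (λ f → map (f ,_) ys) xs ≡ cartesianProduct xs ys
concatMap-pairs []       ys = refl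
concatMap-pairs (x ∷ xs) ys = cong (map (x ,_) ys ++_) (concatMap-pairs xs ys)

∈-allBF : (f : BF n) → f ∈ allBF n
∈-allBF {zero}  false   = here refl
∈-allBF {zero}  true    = there (here refl)
∈-allBF {suc n} (f , g) =
  subst ((f , g) ∈_) (sym (concatMap-pairs (allBF n) (allBF n)))
    (∈-cartesianProduct⁺ (∈-allBF f) (∈-allBF g))

allBF-unique : ∀ n → Unique (allBF n)
allBF-unique zero    = ((λ ()) All.∷ All.[]) AllPairs.∷ (All.[] AllPairs.∷ AllPairs.[])
allBF-unique (suc n) =
  subst Unique (sym (concatMap-pairs (allBF n) (allBF n)))
    (Unique.cartesianProduct⁺ (allBF-unique n) (allBF-unique n))

D-unique : ∀ n → Unique (D n)
D-unique n = Unique.filter⁺ (true? isMono) (allBF-unique n)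

∈-D⁺ : (f : BF n) → f ∈D → f ∈ D n
∈-D⁺ f f-mono = ∈-filter⁺ (true? isMono) (∈-allBF f) f-mono

∈-D⁻ : {f : BF n} → f ∈ D n → f ∈D
∈-D⁻ {n} f∈ = proj₂ (∈-filter⁻ (true? isMono) {xs = allBF n} f∈)

∈-elems⁺ : (P : Sub n) (f : BF n) → f ∈D → P f ≡ true → f ∈ elems P
∈-elems⁺ P f f-mono = ∈-filter⁺ (true? P) (∈-D⁺ f f-mono)

∈-elems⁻ : (P : Sub n) {f : BF n} → f ∈ elems P → f ∈D × P f ≡ true
∈-elems⁻ {n} P f∈ with f∈D , Pf ← ∈-filter⁻ (true? P) {xs = D n} f∈ = ∈-D⁻ f∈D , Pf

eqF⁻ : (f g : BF n) → eqF f g ≡ true → f ≡ g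
eqF⁻ f g f≡g = BF-ext λ u → isYes⁻ (_ ≟ _) (all-true⁻ _ f≡g (∈-allPts u))

eqF-refl : (f : BF n) → eqF f f ≡ true
eqF-refl {n} f = all-true⁺ _ (allPts n) λ {u} _ → isYes⁺ (eval f u ≟ eval f u) refl

ptLe⁻ : (u v : Pt n) → ptLe u v ≡ true → ∀ i → (lookup u i ≤ᵇ lookup v i) ≡ true
ptLe⁻ (a ∷ u) (b ∷ v) u≤v zero    with a ≤ᵇ b
... | true = refl
ptLe⁻ (a ∷ u) (b ∷ v) u≤v (suc i) with a ≤ᵇ b
... | true = ptLe⁻ u v u≤v i

ptLe⁺ : (u v : Pt n) → (∀ i → (lookup u i ≤ᵇ lookup v i) ≡ true) → ptLe u v ≡ true
ptLe⁺ []      []      _   = refl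
ptLe⁺ (a ∷ u) (b ∷ v) u≤v rewrite u≤v zero = ptLe⁺ u v (u≤v ∘ suc)

leF⁻ : (f g : BF n) → leF f g ≡ true → ∀ u → (eval f u ≤ᵇ eval g u) ≡ true
leF⁻ f g f≤g u = all-true⁻ _ f≤g (∈-allPts u)

leF⁺ : (f g : BF n) → (∀ u → (eval f u ≤ᵇ eval g u) ≡ true) → leF f g ≡ true
leF⁺ {n} f g f≤g = all-true⁺ _ (allPts n) λ {u} _ → f≤g u

isMono⁻ : (f : BF n) → f ∈D → ∀ u v → ptLe u v ≡ true → (eval f u ≤ᵇ eval f v) ≡ true
isMono⁻ f f-mono u v = implies⁻ (all-true⁻ _ (all-true⁻ _ f-mono (∈-allPts u)) (∈-allPts v))

isMono⁺ : (f : BF n) → (∀ u v → ptLe u v ≡ true → (eval f u ≤ᵇ eval f v) ≡ true) → f ∈D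
isMono⁺ {n} f f-mono =
  all-true⁺ _ (allPts n) λ {u} _ → all-true⁺ _ (allPts n) λ {v} _ → implies⁺ (ptLe u v) (f-mono u v)

-- Permutations of coordinates and their action

_∘ₚ_ : Vec (Fin n) n → Vec (Fin n) n → Vec (Fin n) n
p ∘ₚ r = tabulate (lookup p ∘ lookup r)

idₚ : Vec (Fin n) n
idₚ = tabulate id

lookup-∘ₚ : (p r : Vec (Fin n) n) (i : Fin n) → lookup (p ∘ₚ r) i ≡ lookup p (lookup r i)
lookup-∘ₚ p r = lookup∘tabulate (lookup p ∘ lookup r)

lookup-idₚ : (i : Fin n) → lookup idₚ i ≡ i
lookup-idₚ = lookup∘tabulate id

idₚ-injective : Injective _≡_ _≡_ (lookup (idₚ {n}))
idₚ-injective {x = i} {y = j} i≡j = trans (sym (lookup-idₚ i)) (trans i≡j (lookup-idₚ j))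

∘ₚ-injective : (p r : Vec (Fin n) n) → Injective _≡_ _≡_ (lookup p) → Injective _≡_ _≡_ (lookup r) →
               Injective _≡_ _≡_ (lookup (p ∘ₚ r))
∘ₚ-injective p r p-inj r-inj {i} {j} e =
  r-inj (p-inj (trans (sym (lookup-∘ₚ p r i)) (trans e (lookup-∘ₚ p r j))))

isInjective⁻ : (p : Vec (Fin n) n) → isInjective p ≡ true → Injective _≡_ _≡_ (lookup p)
isInjective⁻ {n} p p-inj {i} {j} pi≡pj =
  isYes⁻ (i ≟ᶠ j)
    (implies⁻ (all-true⁻ _ (all-true⁻ _ p-inj (∈-allFin i)) (∈-allFin j)) (isYes⁺ (_ ≟ᶠ _) pi≡pj))

isInjective⁺ : (p : Vec (Fin n) n) → Injective _≡_ _≡_ (lookup p) → isInjective p ≡ true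
isInjective⁺ {n} p p-inj =
  all-true⁺ _ (allFin n) λ {i} _ → all-true⁺ _ (allFin n) λ {j} _ →
    implies⁺ ⌊ lookup p i ≟ᶠ lookup p j ⌋
      λ pi≡pj → isYes⁺ (i ≟ᶠ j) (p-inj (isYes⁻ (_ ≟ᶠ _) pi≡pj))

injective⇒surjective : {f : Fin n → Fin n} → Injective _≡_ _≡_ f → ∀ j → ∃[ i ] f i ≡ j
injective⇒surjective {suc n} {f} f-inj j with any? (λ i → f i ≟ᶠ j)
... | yes hit = hit
... | no miss = contradiction (injective⇒≤ punchOut∘f-inj) 1+n≰n
  where
  punchOut∘f : Fin (suc n) → Fin n
  punchOut∘f i = punchOut {i = j} λ j≡fi → miss (i , sym j≡fi)

  punchOut∘f-inj : Injective _≡_ _≡_ punchOut∘f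
  punchOut∘f-inj = f-inj ∘ punchOut-injective {i = j} _ _

∈-allVecs : ∀ {k} (v : Vec (Fin n) k) → v ∈ allVecs k n
∈-allVecs []      = here refl
∈-allVecs {n} {suc k} (i ∷ v) =
  ∈-concatMap⁺ (λ i → map (i ∷_) (allVecs k n))
    (Any.map (λ { refl → ∈-map⁺ (i ∷_) (∈-allVecs v) }) (∈-allFin i))

actPt-∘ₚ : (p r : Vec (Fin n) n) (u : Pt n) → actPt r (actPt p u) ≡ actPt (p ∘ₚ r) u
actPt-∘ₚ p r u = tabulate-cong λ i →
  trans (lookup∘tabulate _ (lookup r i)) (cong (lookup u) (sym (lookup-∘ₚ p r i)))

actPt-id : (c : Vec (Fin n) n) → (∀ i → lookup c i ≡ i) → ∀ u → actPt c u ≡ u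
actPt-id c c≗id u = trans (tabulate-cong (cong (lookup u) ∘ c≗id)) (tabulate∘lookup u)

actPt-preserves-ptLe : (p : Vec (Fin n) n) (u v : Pt n) →
                       ptLe u v ≡ true → ptLe (actPt p u) (actPt p v) ≡ true
actPt-preserves-ptLe p u v u≤v = ptLe⁺ (actPt p u) (actPt p v) λ i →
  subst₂ (λ a b → (a ≤ᵇ b) ≡ true) (sym (lookup∘tabulate _ i)) (sym (lookup∘tabulate _ i))
    (ptLe⁻ u v u≤v (lookup p i))

eval-act : (p : Vec (Fin n) n) (g : BF n) (u : Pt n) → eval (act p g) u ≡ eval g (actPt p u)
eval-act p g = eval-fromFun (eval g ∘ actPt p)

act-fromFun : (p : Vec (Fin n) n) (h : Pt n → Bool) → act p (fromFun h) ≡ fromFun (h ∘ actPt p)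
act-fromFun p h = fromFun-cong (eval-fromFun h ∘ actPt p)

act-act : (p r : Vec (Fin n) n) (h : BF n) → act p (act r h) ≡ act (p ∘ₚ r) h
act-act p r h = fromFun-cong λ u → trans (eval-act r h (actPt p u)) (cong (eval h) (actPt-∘ₚ p r u))

act-id : (c : Vec (Fin n) n) → (∀ i → lookup c i ≡ i) → ∀ h → act c h ≡ h
act-id c c≗id h = trans (fromFun-cong (cong (eval h) ∘ actPt-id c c≗id)) (fromFun-eval h)

∣∣-act : (p : Vec (Fin n) n) (f g : BF n) → (act p f ∣∣ act p g) ≡ act p (f ∣∣ g)
∣∣-act p f g = trans (fromFun-cong λ u → cong₂ _∨_ (eval-act p f u) (eval-act p g u))
                     (sym (act-fromFun p _))

&&-act : (p : Vec (Fin n) n) (f g : BF n) → (act p f && act p g) ≡ act p (f && g)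
&&-act p f g = trans (fromFun-cong λ u → cong₂ _∧_ (eval-act p f u) (eval-act p g u))
                     (sym (act-fromFun p _))

act-bot : (p : Vec (Fin n) n) → act p bot ≡ bot
act-bot p = act-fromFun p _

act-preserves-leF : (p : Vec (Fin n) n) (f g : BF n) →
                    leF f g ≡ true → leF (act p f) (act p g) ≡ true
act-preserves-leF p f g f≤g = leF⁺ _ _ λ u →
  subst₂ (λ a b → (a ≤ᵇ b) ≡ true) (sym (eval-act p f u)) (sym (eval-act p g u))
    (leF⁻ f g f≤g (actPt p u))

act-preserves-isMono : (p : Vec (Fin n) n) (g : BF n) → g ∈D → act p g ∈D
act-preserves-isMono p g g-mono = isMono⁺ _ λ u v u≤v →
  subst₂ (λ a b → (a ≤ᵇ b) ≡ true) (sym (eval-act p g u)) (sym (eval-act p g v))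
    (isMono⁻ g g-mono _ _ (actPt-preserves-ptLe p u v u≤v))

module Inverse (p : Vec (Fin n) n) (p-inj : Injective _≡_ _≡_ (lookup p)) where

  p⁻¹ : Vec (Fin n) n
  p⁻¹ = tabulate (proj₁ ∘ injective⇒surjective p-inj)

  inverseʳ : ∀ j → lookup p (lookup p⁻¹ j) ≡ j
  inverseʳ j = trans (cong (lookup p) (lookup∘tabulate _ j)) (proj₂ (injective⇒surjective p-inj j))

  inverseˡ : ∀ i → lookup p⁻¹ (lookup p i) ≡ i
  inverseˡ i = p-inj (inverseʳ (lookup p i))

  p⁻¹-injective : Injective _≡_ _≡_ (lookup p⁻¹)
  p⁻¹-injective {i} {j} q≡ = trans (sym (inverseʳ i)) (trans (cong (lookup p) q≡) (inverseʳ j))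

  act-act⁻¹ : ∀ h → act p (act p⁻¹ h) ≡ h
  act-act⁻¹ h = trans (act-act p p⁻¹ h)
    (act-id (p ∘ₚ p⁻¹) (λ i → trans (lookup-∘ₚ p p⁻¹ i) (inverseʳ i)) h)

  act⁻¹-act : ∀ h → act p⁻¹ (act p h) ≡ h
  act⁻¹-act h = trans (act-act p⁻¹ p h)
    (act-id (p⁻¹ ∘ₚ p) (λ i → trans (lookup-∘ₚ p⁻¹ p i) (inverseˡ i)) h)

∼-refl : (f : BF n) → f ∼ f
∼-refl {n} f = idₚ , isInjective⁺ {n} idₚ idₚ-injective , sym (act-id idₚ lookup-idₚ f)

∼-sym : {f g : BF n} → f ∼ g → g ∼ f
∼-sym (p , p-perm , refl) = p⁻¹ , isInjective⁺ p⁻¹ p⁻¹-injective , sym (act⁻¹-act _)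
  where open Inverse p (isInjective⁻ p p-perm)

∼-trans : {f g h : BF n} → f ∼ g → g ∼ h → f ∼ h
∼-trans (p , p-perm , refl) (r , r-perm , refl) =
  p ∘ₚ r ,
  isInjective⁺ (p ∘ₚ r) (∘ₚ-injective p r (isInjective⁻ p p-perm) (isInjective⁻ r r-perm)) ,
  act-act p r _

simᵇ⇒∼ : (f g : BF n) → simᵇ f g ≡ true → f ∼ g
simᵇ⇒∼ {n} f g f≈g with p , p∈ , f≡pg ← any-true⁻ _ (Sym n) f≈g =
  p , proj₂ (∈-filter⁻ (true? isInjective) {xs = allVecs n n} p∈) , eqF⁻ _ _ f≡pg

∼⇒simᵇ : {f g : BF n} → f ∼ g → simᵇ f g ≡ true
∼⇒simᵇ {g = g} (p , p-perm , refl) =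
  any-true⁺ _ (∈-filter⁺ (true? isInjective) (∈-allVecs p) p-perm) (eqF-refl (act p g))

simᵇ-refl : (f : BF n) → simᵇ f f ≡ true
simᵇ-refl f = ∼⇒simᵇ (∼-refl f)

simᵇ-sym : (f g : BF n) → simᵇ f g ≡ true → simᵇ g f ≡ true
simᵇ-sym f g = ∼⇒simᵇ ∘ ∼-sym ∘ simᵇ⇒∼ f g

simᵇ-trans : (f g h : BF n) → simᵇ f g ≡ true → simᵇ g h ≡ true → simᵇ f h ≡ true
simᵇ-trans f g h f≈g g≈h = ∼⇒simᵇ (∼-trans (simᵇ⇒∼ f g f≈g) (simᵇ⇒∼ g h g≈h))

γ-∼ : {f g : BF n} → f ∼ g → γ f ≡ γ g
γ-∼ {n} f∼g = cong length (filter-cong (D n) λ _ → bool-ext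
  (λ h≈f → ∼⇒simᵇ (∼-trans (simᵇ⇒∼ _ _ h≈f) f∼g))
  (λ h≈g → ∼⇒simᵇ (∼-trans (simᵇ⇒∼ _ _ h≈g) (∼-sym f∼g))))

class-in-E : (m : ℕ) {g : BF n} → E m g ≡ true → class simᵇ g (elems (E m)) ≡ elems (cls g)
class-in-E {n} m {g} Eg =
  trans (filter-filter (λ h → simᵇ h g) (E m) (D n)) (filter-cong (D n) λ {h} _ → drop-E h)
  where
  drop-E : ∀ h → (simᵇ h g ∧ E m h) ≡ simᵇ h g
  drop-E h with simᵇ h g in h≈g
  ... | true  = trans (cong (λ k → ⌊ m ∣? k ⌋) (γ-∼ (simᵇ⇒∼ h g h≈g))) Eg
  ... | false = refl

-- Invariance of H

elems-cong : {P Q : Sub n} → (∀ {f} → f ∈D → P f ≡ Q f) → elems P ≡ elems Q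
elems-cong {n} P≡Q = filter-cong (D n) (P≡Q ∘ ∈-D⁻)

-- H x y z is definitionally re ⊥ (x & y & z) * cubeSum (x | y) (x | z) (y | z) (x | y | z).
cubeSum : BF n → BF n → BF n → BF n → ℕ
cubeSum a b c d = sum (map (λ s → re a s * re b s * re c s) (elems (leF d)))

module Invariance (p : Vec (Fin n) n) (p-perm : isInjective p ≡ true) where

  open Inverse p (isInjective⁻ p p-perm)

  σ : BF n → BF n
  σ = act p

  act-injective : Injective _≡_ _≡_ σ
  act-injective {f} {g} σf≡σg =
    trans (sym (act⁻¹-act f)) (trans (cong (act p⁻¹) σf≡σg) (act⁻¹-act g))

  leF-act : ∀ f g → leF (σ f) (σ g) ≡ leF f g
  leF-act f g = bool-ext
    (subst₂ (λ a b → leF a b ≡ true) (act⁻¹-act f) (act⁻¹-act g)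
      ∘ act-preserves-leF p⁻¹ (σ f) (σ g))
    (act-preserves-leF p f g)

  elems-act : (P : Sub n) → map σ (elems (P ∘ σ)) ↭ elems P
  elems-act P = unique-⇔⇒↭
    (Unique.map⁺ act-injective (Unique.filter⁺ _ (D-unique n))) (Unique.filter⁺ _ (D-unique n))
    to from
    where
    to : ∀ {f} → f ∈ map σ (elems (P ∘ σ)) → f ∈ elems P
    to f∈ with g , g∈ , refl ← ∈-map⁻ σ f∈ with g-mono , Pσg ← ∈-elems⁻ (P ∘ σ) g∈ =
      ∈-elems⁺ P (σ g) (act-preserves-isMono p g g-mono) Pσg

    from : ∀ {f} → f ∈ elems P → f ∈ map σ (elems (P ∘ σ))
    from {f} f∈ with f-mono , Pf ← ∈-elems⁻ P f∈ =
      subst (_∈ map σ (elems (P ∘ σ))) (act-act⁻¹ f)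
        (∈-map⁺ σ (∈-elems⁺ (P ∘ σ) (act p⁻¹ f) (act-preserves-isMono p⁻¹ f f-mono)
          (subst (λ g → P g ≡ true) (sym (act-act⁻¹ f)) Pf)))

  length-elems-act : (P : Sub n) → length (elems (P ∘ σ)) ≡ length (elems P)
  length-elems-act P = trans (sym (length-map σ (elems (P ∘ σ)))) (↭-length (elems-act P))

  sum-elems-act : (P : Sub n) (F : BF n → ℕ) →
                  sum (map F (elems P)) ≡ sum (map (F ∘ σ) (elems (P ∘ σ)))
  sum-elems-act P F =
    trans (sym (sum-map-↭ F (elems-act P))) (cong sum (sym (map-∘ (elems (P ∘ σ)))))

  re-act : ∀ a b → re (σ a) (σ b) ≡ re a b
  re-act a b = begin
    re (σ a) (σ b)
      ≡⟨ length-elems-act _ ⟨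
    length (elems (λ z → leF (σ a) (σ z) ∧ leF (σ z) (σ b)))
      ≡⟨ cong length (elems-cong λ {z} _ → cong₂ _∧_ (leF-act a z) (leF-act z b)) ⟩
    re a b
      ∎
    where open ≡-Reasoning

  cubeSum-act : ∀ a b c d → cubeSum (σ a) (σ b) (σ c) (σ d) ≡ cubeSum a b c d
  cubeSum-act a b c d = begin
    cubeSum (σ a) (σ b) (σ c) (σ d)
      ≡⟨ sum-elems-act _ _ ⟩
    sum (map (λ s → re (σ a) (σ s) * re (σ b) (σ s) * re (σ c) (σ s)) (elems (leF (σ d) ∘ σ)))
      ≡⟨ cong sum (map-cong product-act (elems (leF (σ d) ∘ σ))) ⟩
    sum (map product (elems (leF (σ d) ∘ σ)))
      ≡⟨ cong (sum ∘ map product) (elems-cong λ {s} _ → leF-act d s) ⟩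
    cubeSum a b c d
      ∎
    where
    open ≡-Reasoning
    product : BF n → ℕ
    product s = re a s * re b s * re c s
    product-act : ∀ s → re (σ a) (σ s) * re (σ b) (σ s) * re (σ c) (σ s) ≡ product s
    product-act s = cong₂ _*_ (cong₂ _*_ (re-act a s) (re-act b s)) (re-act c s)

  H-act : ∀ x y z → H (σ x) (σ y) (σ z) ≡ H x y z
  H-act x y z = cong₂ _*_ meet-part join-part
    where
    meet-part : re bot (σ x && (σ y && σ z)) ≡ re bot (x && (y && z))
    meet-part rewrite &&-act p y z | &&-act p x (y && z) =
      trans (cong (λ b → re b (σ (x && (y && z)))) (sym (act-bot p))) (re-act bot (x && (y && z)))

    join-part : cubeSum (σ x ∣∣ σ y) (σ x ∣∣ σ z) (σ y ∣∣ σ z) ((σ x ∣∣ σ y) ∣∣ σ z)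
              ≡ cubeSum (x ∣∣ y) (x ∣∣ z) (y ∣∣ z) ((x ∣∣ y) ∣∣ z)
    join-part rewrite ∣∣-act p x y | ∣∣-act p x z | ∣∣-act p y z | ∣∣-act p (x ∣∣ y) z =
      cubeSum-act _ _ _ _

  module _ {Y : Sub n} (Y-inv : Invariant Y) where

    Y-act : ∀ {b} → b ∈D → Y (σ b) ≡ Y b
    Y-act {b} b-mono = bool-ext from-σ to-σ
      where
      from-σ : Y (σ b) ≡ true → Y b ≡ true
      from-σ Yσb
        with f , (_ , Yf) , σf≡σb ← proj₁ (Y-inv p p-perm (σ b)) (act-preserves-isMono p b b-mono , Yσb) =
        subst (λ g → Y g ≡ true) (act-injective σf≡σb) Yf

      to-σ : Y b ≡ true → Y (σ b) ≡ true
      to-σ Yb = proj₂ (proj₂ (Y-inv p p-perm (σ b)) (b , (b-mono , Yb) , refl))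

    sum-elems-invariant : (F : BF n → ℕ) → sum (map F (elems Y)) ≡ sum (map (F ∘ σ) (elems Y))
    sum-elems-invariant F = trans (sum-elems-act Y F) (cong (sum ∘ map (F ∘ σ)) (elems-cong Y-act))

-- Row sums

rowSum : Sub n → Sub n → BF n → ℕ
rowSum Y Z x = sum (map (λ y → sum (map (H x y) (elems Z))) (elems Y))

Hprod-rowSum : (P Y Z : Sub n) → Hprod P Y Z ≡ sum (map (rowSum Y Z) (elems P))
Hprod-rowSum P Y Z = trans (sum-concatMap _ (elems P))
  (cong sum (map-cong (λ x → sum-concatMap _ (elems Y)) (elems P)))

module _ {Y Z : Sub n} (Y-inv : Invariant Y) (Z-inv : Invariant Z) where

  rowSum-∼ : {f g : BF n} → f ∼ g → rowSum Y Z f ≡ rowSum Y Z g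
  rowSum-∼ (p , p-perm , refl) =
    trans (sum-elems-invariant Y-inv _) (cong sum (map-cong row-act (elems Y)))
    where
    open Invariance p p-perm
    row-act : ∀ y → sum (map (H (σ _) (σ y)) (elems Z)) ≡ sum (map (H _ y) (elems Z))
    row-act y = trans (sum-elems-invariant Z-inv _) (cong sum (map-cong (H-act _ y) (elems Z)))

  Hprod-single : {x : BF n} → x ∈D → Hprod (single x) Y Z ≡ rowSum Y Z x
  Hprod-single {x} x-mono = begin
    Hprod (single x) Y Z                       ≡⟨ Hprod-rowSum (single x) Y Z ⟩
    sum (map (rowSum Y Z) (elems (single x)))  ≡⟨ sum-map-↭ (rowSum Y Z) elems-single ⟩
    rowSum Y Z x + 0                           ≡⟨ +-identityʳ _ ⟩
    rowSum Y Z x                               ∎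
    where
    open ≡-Reasoning
    elems-single : elems (single x) ↭ x ∷ []
    elems-single = unique-⇔⇒↭ (Unique.filter⁺ _ (D-unique _)) (All.[] AllPairs.∷ AllPairs.[])
      (λ f∈ → here (eqF⁻ _ _ (proj₂ (∈-elems⁻ (single x) f∈))))
      (λ { (here refl) → ∈-elems⁺ (single x) x x-mono (eqF-refl x) })

  sum-rowSum-cls : (x : BF n) → sum (map (rowSum Y Z) (elems (cls x))) ≡ γ x * rowSum Y Z x
  sum-rowSum-cls x = begin
    sum (map (rowSum Y Z) (elems (cls x)))
      ≡⟨ cong sum (map-cong-local (All.tabulate on-class)) ⟩
    sum (map (λ _ → rowSum Y Z x) (elems (cls x)))
      ≡⟨ sum-map-const _ (elems (cls x)) ⟩
    γ x * rowSum Y Z x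
      ∎
    where
    open ≡-Reasoning
    on-class : ∀ {g} → g ∈ elems (cls x) → rowSum Y Z g ≡ rowSum Y Z x
    on-class g∈ = rowSum-∼ (simᵇ⇒∼ _ x (proj₂ (∈-elems⁻ (cls x) g∈)))

  Hprod-cls : (x : BF n) → Hprod (cls x) Y Z ≡ γ x * rowSum Y Z x
  Hprod-cls x = trans (Hprod-rowSum (cls x) Y Z) (sum-rowSum-cls x)

  ∣-Hprod-E : (m : ℕ) → m ∣ Hprod (E m) Y Z
  ∣-Hprod-E m = subst (m ∣_) (sym (Hprod-rowSum (E m) Y Z))
    (∣-sum-by-classes simᵇ simᵇ-refl simᵇ-sym simᵇ-trans (rowSum Y Z) m (elems (E m)) class∣)
    where
    class∣ : ∀ {g} → g ∈ elems (E m) → m ∣ sum (map (rowSum Y Z) (class simᵇ g (elems (E m))))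
    class∣ {g} g∈ with _ , Eg ← ∈-elems⁻ (E m) g∈ =
      subst (m ∣_) (sym class-sum) (∣m⇒∣m*n _ (isYes⁻ (m ∣? γ g) Eg))
      where
      class-sum : sum (map (rowSum Y Z) (class simᵇ g (elems (E m)))) ≡ γ g * rowSum Y Z g
      class-sum = trans (cong (sum ∘ map (rowSum Y Z)) (class-in-E m Eg)) (sum-rowSum-cls g)

-- The hypothesis 1 < m is unused: all four claims hold for every m.
lemma9 : (n m : ℕ) → 1 < m → (Y Z : Sub n) → Invariant Y → Invariant Z →
    (x y : BF n) → x ∈D → y ∈D → x ∼ y →
    (Hprod (single x) Y Z ≡ Hprod (single y) Y Z)
    × (Hprod (cls x) Y Z ≡ γ x * Hprod (single x) Y Z)
    × (m ∣ γ x → m ∣ Hprod (cls x) Y Z)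
    × (m ∣ Hprod (E m) Y Z)
lemma9 n m _ Y Z Y-inv Z-inv x y x-mono y-mono x∼y =
  single-x≡single-y , cls≡γ*single , (λ m∣γ → subst (m ∣_) (sym cls≡γ*single) (∣m⇒∣m*n _ m∣γ)) ,
  ∣-Hprod-E Y-inv Z-inv m
  where
  open ≡-Reasoning
  single-x≡single-y : Hprod (single x) Y Z ≡ Hprod (single y) Y Z
  single-x≡single-y = begin
    Hprod (single x) Y Z  ≡⟨ Hprod-single Y-inv Z-inv x-mono ⟩
    rowSum Y Z x          ≡⟨ rowSum-∼ Y-inv Z-inv x∼y ⟩
    rowSum Y Z y          ≡⟨ Hprod-single Y-inv Z-inv y-mono ⟨
    Hprod (single y) Y Z  ∎

  cls≡γ*single : Hprod (cls x) Y Z ≡ γ x * Hprod (single x) Y Z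
  cls≡γ*single = begin
    Hprod (cls x) Y Z            ≡⟨ Hprod-cls Y-inv Z-inv x ⟩
    γ x * rowSum Y Z x           ≡⟨ cong (γ x *_) (Hprod-single Y-inv Z-inv x-mono) ⟨
    γ x * Hprod (single x) Y Z   ∎
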